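{- Let $A$ be a commutative unital ring of characteristic $0$, let $n\ge4$, let $k\in\{3,\ldots,n-1\}$ and let $(b_1,\ldots,b_k)\in A^k$. Then $(b_1,\ldots,b_k)$ can be used to reduce $(1_A,n_A-2_A,1_A,2_A,\ldots,2_A)$ (the last $n-3$ entries equal to $2_A$) if and only if $(b_1,\ldots,b_k)=(k_A-2_A,1_A,2_A,\ldots,2_A,1_A)$ or $(b_1,\ldots,b_k)=(1_A,2_A,\ldots,2_A,1_A,k_A-2_A)$ (the number of entries $2_A$ possibly being zero).
   Context: For $a_1,\ldots,a_n\in A$, $M_n(a_1,\ldots,a_n)=\begin{pmatrix}a_n&-1\\1&0\end{pmatrix}\cdots\begin{pmatrix}a_1&-1\\1&0\end{pmatrix}$; an $n$-tuple is a $\lambda$-quiddity over $A$ if $M_n(a_1,\ldots,a_n)=\pm Id$. For $k\in\mathbb{N}^*$, $k_A=\sum_{i=1}^k1_A$. For $(a_1,\ldots,a_n)\in A^n$, $(b_1,\ldots,b_m)\in A^m$, $(a_1,\ldots,a_n)\oplus(b_1,\ldots,b_m)=(a_1+b_m,a_2,\ldots,a_{n-1},a_n+b_1,b_2,\ldots,b_{m-1})$. $(a_1,\ldots,a_n)\sim(b_1,\ldots,b_n)$ means $(b_1,\ldots,b_n)$ is obtained by a cyclic permutation of $(a_1,\ldots,a_n)$ or of $(a_n,\ldots,a_1)$. A $k$-tuple $(b_1,\ldots,b_k)$ "can be used to reduce" an $n$-tuple $(a_1,\ldots,a_n)$ if $(b_1,\ldots,b_k)$ is a $\lambda$-quiddity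 over $A$ and there exists $(c_1,\ldots,c_{n+2-k})\in A^{n+2-k}$ with $(a_1,\ldots,a_n)\sim(c_1,\ldots,c_{n+2-k})\oplus(b_1,\ldots,b_k)$. -}

module Defs where

open import Level using (Level; _⊔_)
open import Algebra.Bundles using (CommutativeRing)
open import Data.Nat using (ℕ; zero; suc; _∸_) renaming (_+_ to _+ℕ_)
open import Data.Product using (Σ; _×_; ∃)
open import Data.Sum using (_⊎_)
open import Data.Empty using (⊥)
open import Data.List using (List; []; _∷_; _++_; [_]; length; drop; take; reverse; replicate)
open import Data.List.Relation.Binary.Pointwise using (Pointwise)
open import Relation.Binary.PropositionalEquality using (_≡_)

module Over {c ℓ : Level} (R : CommutativeRing c ℓ) where
  open CommutativeRing R

  _ₐ : ℕ → Carrier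
  zero ₐ  = 0#
  suc k ₐ = 1# + k ₐ

  CharZero : Set ℓ
  CharZero = ∀ m → (suc m) ₐ ≈ 0# → ⊥

  record Mat : Set c where
    constructor mat
    field
      e₁₁ e₁₂ e₂₁ e₂₂ : Carrier

  _⊗_ : Mat → Mat → Mat
  mat a b c' d ⊗ mat a' b' c'' d' =
    mat (a * a' + b * c'') (a * b' + b * d') (c' * a' + d * c'') (c' * b' + d * d')

  Id : Mat
  Id = mat 1# 0# 0# 1#

  -Id : Mat
  -Id = mat (- 1#) 0# 0# (- 1#)

  _≈M_ : Mat → Mat → Set ℓ
  mat a b c' d ≈M mat a' b' c'' d' = (a ≈ a') × (b ≈ b') × (c' ≈ c'') × (d ≈ d')

  elem : Carrier → Mat
  elem a = mat a (- 1#) 1# 0#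

  M : List Carrier → Mat
  M []       = Id
  M (a ∷ as) = M as ⊗ elem a

  IsQuiddity : List Carrier → Set ℓ
  IsQuiddity as = (M as ≈M Id) ⊎ (M as ≈M -Id)

  -- first / last / middle entries (only used on tuples of length ≥ 2)
  hd : List Carrier → Carrier
  hd []      = 0#
  hd (x ∷ _) = x

  lst : List Carrier → Carrier
  lst []           = 0#
  lst (x ∷ [])     = x
  lst (_ ∷ y ∷ ys) = lst (y ∷ ys)

  mid : List Carrier → List Carrier
  mid xs = take (length xs ∸ 2) (drop 1 xs)

  -- (a₁,…,aₙ) ⊕ (b₁,…,bₘ) = (a₁+bₘ, a₂,…,aₙ₋₁, aₙ+b₁, b₂,…,bₘ₋₁)
  _⊕_ : List Carrier → List Carrier → List Carrier
  as ⊕ bs = (hd as + lst bs) ∷ (mid as ++ ((lst as + hd bs) ∷ mid bs))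

  _≋_ : List Carrier → List Carrier → Set (c ⊔ ℓ)
  _≋_ = Pointwise _≈_

  rotate : ℕ → List Carrier → List Carrier
  rotate i xs = drop i xs ++ take i xs

  _∼_ : List Carrier → List Carrier → Set (c ⊔ ℓ)
  as ∼ bs = ∃ λ i → (bs ≋ rotate i as) ⊎ (bs ≋ rotate i (reverse as))

  CanReduce : List Carrier → List Carrier → Set (c ⊔ ℓ)
  CanReduce bs as =
    IsQuiddity bs ×
    Σ (List Carrier) λ cs → (length cs ≡ length as +ℕ 2 ∸ length bs) × (as ∼ (cs ⊕ bs))

  target : ℕ → List Carrier
  target n = 1# ∷ (n ₐ - 2 ₐ) ∷ 1# ∷ replicate (n ∸ 3) (2 ₐ)

  sol₁ : ℕ → List Carrier
  sol₁ k = (k ₐ - 2 ₐ) ∷ 1# ∷ (replicate (k ∸ 3) (2 ₐ) ++ [ 1# ])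

  sol₂ : ℕ → List Carrier
  sol₂ k = 1# ∷ (replicate (k ∸ 3) (2 ₐ) ++ (1# ∷ (k ₐ - 2 ₐ) ∷ []))

module Submission where

-- Write a reducing k-tuple as (x, W, y). Then cs ⊕ (x, W, y) ends with W, so W is a window of
-- length k - 2 ≤ n - 3 in a rotation of the cycle (1, n-2, 1, 2, …, 2), and
-- M (x, W, y) = elem y · M W · elem x can only be ±Id if the top-left entry of M W is ±1.
-- The only windows whose top-left entry is 1 are (1, 2, …, 2) and (2, …, 2, 1), and they force
-- (x, y) = (k-2, 1), resp. (1, k-2); every other window has top-left entry m ≥ 2 for an
-- integer m, which is not ±1 in characteristic 0. Conversely, these two tuples are λ-quiddities
-- because det (M W) = 1, and with s = n - k - 1 the tuples cs = (1, 2ˢ, 1, s+1), resp.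
-- cs = (s+1, 1, 2ˢ, 1), give cs ⊕ (b₁, …, bₖ) ∼ (1, n-2, 1, 2, …, 2).

open import Defs
open import Algebra.Bundles using (CommutativeRing)
open import Data.Nat using (ℕ; _≤_; _<_)
open import Data.List using (List; length)
open import Data.Sum using (_⊎_)
open import Function.Bundles using (_⇔_)
open import Relation.Binary.PropositionalEquality using (_≡_)

module IntegerCoefficientSolver {c ℓ} (R : CommutativeRing c ℓ) where
  open import Data.Nat as ℕ using (zero; suc)
  open import Data.Integer as ℤ using (ℤ; +_; -[1+_]; _⊖_; _◃_)
  import Data.Integer.Properties as ℤ
  import Data.Nat.Properties as ℕ
  open import Data.Sign as Sign using ()
  open import Data.Maybe using (Maybe; just; nothing)
  open import Relation.Nullary using (yes; no)
  open import Relation.Binary.PropositionalEquality as ≡ using (_≡_)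
  open import Algebra.Solver.Ring.AlmostCommutativeRing
    using (fromCommutativeRing; _-Raw-AlmostCommutative⟶_)
  import Algebra.Solver.Ring as RingSolver

  open CommutativeRing R
  open import Algebra.Properties.Ring ring using (-‿involutive; -0#≈0#; -‿distribˡ-*; -‿distribʳ-*; -‿+-comm)
  open import Algebra.Properties.Semiring.Mult.TCOptimised semiring using (_×_; 1+×; ×-homo-+; ×1-homo-*)
  open import Relation.Binary.Reasoning.Setoid setoid

  -- With the type-checking optimised _×_, ⟦ + 1 ⟧ℤ is 1# on the nose, so the solver's
  -- output matches goals stated with 1#.
  ⟦_⟧ℤ : ℤ → Carrier
  ⟦ + n ⟧ℤ      = n × 1#
  ⟦ -[1+ n ] ⟧ℤ = - (suc n × 1#)

  ⟦⊖⟧ : ∀ m n → ⟦ m ⊖ n ⟧ℤ ≈ m × 1# - n × 1#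
  ⟦⊖⟧ m zero rewrite ℤ.⊖-≥ {m} {0} ℕ.z≤n = sym (trans (+-congˡ -0#≈0#) (+-identityʳ _))
  ⟦⊖⟧ zero (suc n) rewrite ℤ.⊖-≤ {0} {suc n} ℕ.z≤n = sym (+-identityˡ _)
  ⟦⊖⟧ (suc m) (suc n) rewrite ℤ.[1+m]⊖[1+n]≡m⊖n m n = begin
    ⟦ m ⊖ n ⟧ℤ                       ≈⟨ ⟦⊖⟧ m n ⟩
    a - b                            ≈⟨ +-congʳ (+-identityʳ a) ⟨
    (a + 0#) - b                     ≈⟨ +-congʳ (+-congˡ (-‿inverseʳ 1#)) ⟨
    (a + (1# - 1#)) - b              ≈⟨ +-congʳ (+-assoc a 1# (- 1#)) ⟨
    ((a + 1#) - 1#) - b              ≈⟨ +-assoc (a + 1#) (- 1#) (- b) ⟩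
    (a + 1#) + (- 1# - b)            ≈⟨ +-cong (+-comm a 1#) (-‿+-comm 1# b) ⟩
    (1# + a) - (1# + b)              ≈⟨ +-cong (1+× m 1#) (-‿cong (1+× n 1#)) ⟨
    suc m × 1# - suc n × 1#          ∎
    where
    a b : Carrier
    a = m × 1#
    b = n × 1#

  ⟦+⟧ : ∀ i j → ⟦ i ℤ.+ j ⟧ℤ ≈ ⟦ i ⟧ℤ + ⟦ j ⟧ℤ
  ⟦+⟧ (+ m)    (+ n)    = ×-homo-+ 1# m n
  ⟦+⟧ (+ m)    -[1+ n ] = ⟦⊖⟧ m (suc n)
  ⟦+⟧ -[1+ m ] (+ n)    = trans (⟦⊖⟧ n (suc m)) (+-comm _ _)
  ⟦+⟧ -[1+ m ] -[1+ n ] = begin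
    - (suc (suc (m ℕ.+ n)) × 1#)     ≡⟨ ≡.cong (λ k → - (suc k × 1#)) (ℕ.+-suc m n) ⟨
    - ((suc m ℕ.+ suc n) × 1#)       ≈⟨ -‿cong (×-homo-+ 1# (suc m) (suc n)) ⟩
    - (suc m × 1# + suc n × 1#)      ≈⟨ -‿+-comm _ _ ⟨
    - (suc m × 1#) - suc n × 1#      ∎

  ⟦-⟧ : ∀ i → ⟦ ℤ.- i ⟧ℤ ≈ - ⟦ i ⟧ℤ
  ⟦-⟧ (+ zero)  = sym -0#≈0#
  ⟦-⟧ (+ suc n) = refl
  ⟦-⟧ -[1+ n ]  = sym (-‿involutive _)

  ⟦+◃⟧ : ∀ n → ⟦ Sign.+ ◃ n ⟧ℤ ≈ n × 1#
  ⟦+◃⟧ zero    = refl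
  ⟦+◃⟧ (suc n) = refl

  ⟦-◃⟧ : ∀ n → ⟦ Sign.- ◃ n ⟧ℤ ≈ - (n × 1#)
  ⟦-◃⟧ zero    = sym -0#≈0#
  ⟦-◃⟧ (suc n) = refl

  ⟦*⟧ : ∀ i j → ⟦ i ℤ.* j ⟧ℤ ≈ ⟦ i ⟧ℤ * ⟦ j ⟧ℤ
  ⟦*⟧ (+ m)    (+ n)    = trans (⟦+◃⟧ (m ℕ.* n)) (×1-homo-* m n)
  ⟦*⟧ (+ m)    -[1+ n ] =
    trans (⟦-◃⟧ (m ℕ.* suc n)) (trans (-‿cong (×1-homo-* m (suc n))) (-‿distribʳ-* _ _))
  ⟦*⟧ -[1+ m ] (+ n)    =
    trans (⟦-◃⟧ (suc m ℕ.* n)) (trans (-‿cong (×1-homo-* (suc m) n)) (-‿distribˡ-* _ _))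
  ⟦*⟧ -[1+ m ] -[1+ n ] = begin
    (suc m ℕ.* suc n) × 1#            ≈⟨ ×1-homo-* (suc m) (suc n) ⟩
    x * y                             ≈⟨ -‿involutive _ ⟨
    - - (x * y)                       ≈⟨ -‿cong (-‿distribʳ-* x y) ⟩
    - (x * - y)                       ≈⟨ -‿distribˡ-* x (- y) ⟩
    - x * - y                         ∎
    where
    x y : Carrier
    x = suc m × 1#
    y = suc n × 1#

  ℤ⟶R : CommutativeRing.rawRing ℤ.+-*-commutativeRing -Raw-AlmostCommutative⟶ fromCommutativeRing R
  ℤ⟶R = record
    { ⟦_⟧ = ⟦_⟧ℤ ; +-homo = ⟦+⟧ ; *-homo = ⟦*⟧ ; -‿homo = ⟦-⟧ ; 0-homo = refl ; 1-homo = refl }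

  ℤ-weaklyDecidable : ∀ i j → Maybe (⟦ i ⟧ℤ ≈ ⟦ j ⟧ℤ)
  ℤ-weaklyDecidable i j with i ℤ.≟ j
  ... | yes ≡.refl = just refl
  ... | no _       = nothing

  open RingSolver _ _ ℤ⟶R ℤ-weaklyDecidable public

module Lists where
  open import Data.List using ([]; _∷_; _++_; [_]; drop; take; replicate; reverse)
  open import Data.Nat using (zero; suc; _+_; _∸_; _⊓_)
  import Data.Nat.Properties as ℕ
  import Data.List.Properties as List
  open import Data.Product using (_×_; _,_; proj₂)
  open import Relation.Binary.PropositionalEquality using (refl; cong; trans; module ≡-Reasoning)
  open import Data.List.Relation.Binary.Pointwise using (Pointwise; []; _∷_; Pointwise-length)

  module _ {a} {A : Set a} where

    data Bracketed : List A → Set a where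
      bracket : ∀ x zs y → Bracketed (x ∷ zs ++ [ y ])

    ∷-bracket : ∀ x {xs} → Bracketed xs → Bracketed (x ∷ xs)
    ∷-bracket x (bracket y zs w) = bracket x (y ∷ zs) w

    bracketed : ∀ {n} xs → length xs ≡ suc (suc n) → Bracketed xs
    bracketed         (x ∷ y ∷ [])     _   = bracket x [] y
    bracketed {suc _} (x ∷ y ∷ z ∷ xs) len = ∷-bracket x (bracketed (y ∷ z ∷ xs) (ℕ.suc-injective len))

    take-length-++ : ∀ (xs ys : List A) → take (length xs) (xs ++ ys) ≡ xs
    take-length-++ []       ys = refl
    take-length-++ (x ∷ xs) ys = cong (x ∷_) (take-length-++ xs ys)

    replicate-+ : ∀ m n (x : A) → replicate (m + n) x ≡ replicate m x ++ replicate n x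
    replicate-+ zero    n x = refl
    replicate-+ (suc m) n x = cong (x ∷_) (replicate-+ m n x)

    length-∷ʳ : ∀ xs (x : A) → length (xs ++ [ x ]) ≡ suc (length xs)
    length-∷ʳ []       x = refl
    length-∷ʳ (_ ∷ xs) x = cong suc (length-∷ʳ xs x)

    replicate-∷ʳ : ∀ n (x : A) → replicate n x ++ [ x ] ≡ x ∷ replicate n x
    replicate-∷ʳ zero    x = refl
    replicate-∷ʳ (suc n) x = cong (x ∷_) (replicate-∷ʳ n x)

    reverse-replicate : ∀ n (x : A) → reverse (replicate n x) ≡ replicate n x
    reverse-replicate zero    x = refl
    reverse-replicate (suc n) x = trans (List.unfold-reverse x (replicate n x))
      (trans (cong (_++ [ x ]) (reverse-replicate n x)) (replicate-∷ʳ n x))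

    drop-replicate : ∀ m n (x : A) → drop m (replicate n x) ≡ replicate (n ∸ m) x
    drop-replicate zero    n       x = refl
    drop-replicate (suc m) zero    x = refl
    drop-replicate (suc m) (suc n) x = drop-replicate m n x

    take-replicate : ∀ m n (x : A) → take m (replicate n x) ≡ replicate (m ⊓ n) x
    take-replicate zero    n       x = refl
    take-replicate (suc m) zero    x = refl
    take-replicate (suc m) (suc n) x = cong (x ∷_) (take-replicate m n x)

    drop-replicate-+-++ : ∀ m n (x : A) ys → drop m (replicate (m + n) x ++ ys) ≡ replicate n x ++ ys
    drop-replicate-+-++ zero    n x ys = refl
    drop-replicate-+-++ (suc m) n x ys = drop-replicate-+-++ m n x ys

    take-replicate-+-++ : ∀ m n (x : A) ys → take m (replicate (m + n) x ++ ys) ≡ replicate m x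
    take-replicate-+-++ zero    n x ys = refl
    take-replicate-+-++ (suc m) n x ys = cong (x ∷_) (take-replicate-+-++ m n x ys)

    drop-+-replicate-++ : ∀ m n (x : A) ys → drop (m + n) (replicate m x ++ ys) ≡ drop n ys
    drop-+-replicate-++ zero    n x ys = refl
    drop-+-replicate-++ (suc m) n x ys = drop-+-replicate-++ m n x ys

    take-+-replicate-++ : ∀ m n (x : A) ys → take (m + n) (replicate m x ++ ys) ≡ replicate m x ++ take n ys
    take-+-replicate-++ zero    n x ys = refl
    take-+-replicate-++ (suc m) n x ys = cong (x ∷_) (take-+-replicate-++ m n x ys)

  module _ {a r} {A : Set a} {R : A → A → Set r} where

    ++⁻ : ∀ ws xs {ys zs} → length ws ≡ length xs → Pointwise R (ws ++ ys) (xs ++ zs) →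
          Pointwise R ws xs × Pointwise R ys zs
    ++⁻ []       []       _  ps       = [] , ps
    ++⁻ (w ∷ ws) (x ∷ xs) eq (p ∷ ps) with ++⁻ ws xs (ℕ.suc-injective eq) ps
    ... | ps₁ , ps₂ = p ∷ ps₁ , ps₂

    ++⁻ʳ : ∀ ws xs {ys zs} → length ys ≡ length zs → Pointwise R (ws ++ ys) (xs ++ zs) → Pointwise R ys zs
    ++⁻ʳ ws xs {ys} {zs} eq ps = proj₂ (++⁻ ws xs prefix-length ps)
      where
      prefix-length : length ws ≡ length xs
      prefix-length = ℕ.+-cancelʳ-≡ (length ys) (length ws) (length xs) (begin
        length ws + length ys   ≡⟨ List.length-++ ws ⟨
        length (ws ++ ys)       ≡⟨ Pointwise-length ps ⟩
        length (xs ++ zs)       ≡⟨ List.length-++ xs ⟩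
        length xs + length zs   ≡⟨ cong (length xs +_) eq ⟨
        length xs + length ys   ∎)
        where open ≡-Reasoning

module Matrices {c ℓ} (R : CommutativeRing c ℓ) where
  open import Data.Nat as ℕ using (zero; suc)
  open import Data.Integer using (+_)
  open import Data.Product using (_×_; _,_; proj₁)
  open import Data.Sum using (inj₁; inj₂)
  open import Data.List using ([]; _∷_; _++_; [_]; replicate)
  open import Data.List.Relation.Binary.Pointwise using ([]; _∷_)
  open CommutativeRing R
  open Over R
  open IntegerCoefficientSolver R using (solve; _:=_; _:+_; _:*_; _:-_; :-_; con; Polynomial)

  ≈M-refl : ∀ {A} → A ≈M A
  ≈M-refl {mat _ _ _ _} = refl , refl , refl , refl

  ≈M-sym : ∀ {A B} → A ≈M B → B ≈M A
  ≈M-sym {mat _ _ _ _} {mat _ _ _ _} (p , q , r , s) = sym p , sym q , sym r , sym s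

  ≈M-trans : ∀ {A B C} → A ≈M B → B ≈M C → A ≈M C
  ≈M-trans {mat _ _ _ _} {mat _ _ _ _} {mat _ _ _ _} (p , q , r , s) (p′ , q′ , r′ , s′) =
    trans p p′ , trans q q′ , trans r r′ , trans s s′

  ⊗-cong : ∀ {A A′ B B′} → A ≈M A′ → B ≈M B′ → (A ⊗ B) ≈M (A′ ⊗ B′)
  ⊗-cong {mat _ _ _ _} {mat _ _ _ _} {mat _ _ _ _} {mat _ _ _ _}
         (p , q , r , s) (p′ , q′ , r′ , s′) =
    +-cong (*-cong p p′) (*-cong q r′) , +-cong (*-cong p q′) (*-cong q s′) ,
    +-cong (*-cong r p′) (*-cong s r′) , +-cong (*-cong r q′) (*-cong s s′)

  -- Matrices of polynomials: each entry of a matrix identity is one call to the solver.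
  record PMat (n : ℕ) : Set c where
    constructor pmat
    field p₁₁ p₁₂ p₂₁ p₂₂ : Polynomial n
  open PMat

  _⊗ₚ_ : ∀ {n} → PMat n → PMat n → PMat n
  pmat a b c′ d ⊗ₚ pmat a′ b′ c″ d′ =
    pmat (a :* a′ :+ b :* c″) (a :* b′ :+ b :* d′) (c′ :* a′ :+ d :* c″) (c′ :* b′ :+ d :* d′)

  :0 :1 : ∀ {n} → Polynomial n
  :0 = con (+ 0)
  :1 = con (+ 1)

  _ₚ : ∀ {n} → ℕ → Polynomial n
  zero ₚ  = :0
  suc k ₚ = :1 :+ k ₚ

  Idₚ : ∀ {n} → PMat n
  Idₚ = pmat :1 :0 :0 :1

  elemₚ : ∀ {n} → Polynomial n → PMat n
  elemₚ a = pmat a (:- :1) :1 :0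

  ⊗-assoc : ∀ A B C → ((A ⊗ B) ⊗ C) ≈M (A ⊗ (B ⊗ C))
  ⊗-assoc (mat a b c′ d) (mat e f g h) (mat i j k l) =
    solve 12 (λ a b c′ d e f g h i j k l → p₁₁ (lhs a b c′ d e f g h i j k l) := p₁₁ (rhs a b c′ d e f g h i j k l))
             refl a b c′ d e f g h i j k l ,
    solve 12 (λ a b c′ d e f g h i j k l → p₁₂ (lhs a b c′ d e f g h i j k l) := p₁₂ (rhs a b c′ d e f g h i j k l))
             refl a b c′ d e f g h i j k l ,
    solve 12 (λ a b c′ d e f g h i j k l → p₂₁ (lhs a b c′ d e f g h i j k l) := p₂₁ (rhs a b c′ d e f g h i j k l))
             refl a b c′ d e f g h i j k l ,
    solve 12 (λ a b c′ d e f g h i j k l → p₂₂ (lhs a b c′ d e f g h i j k l) := p₂₂ (rhs a b c′ d e f g h i j k l))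
             refl a b c′ d e f g h i j k l
    where
    lhs rhs : ∀ {n} (a b c′ d e f g h i j k l : Polynomial n) → PMat n
    lhs a b c′ d e f g h i j k l = (pmat a b c′ d ⊗ₚ pmat e f g h) ⊗ₚ pmat i j k l
    rhs a b c′ d e f g h i j k l = pmat a b c′ d ⊗ₚ (pmat e f g h ⊗ₚ pmat i j k l)

  ⊗-identityʳ : ∀ A → (A ⊗ Id) ≈M A
  ⊗-identityʳ (mat a b c′ d) =
    solve 4 (λ a b c′ d → p₁₁ (pmat a b c′ d ⊗ₚ Idₚ) := a) refl a b c′ d ,
    solve 4 (λ a b c′ d → p₁₂ (pmat a b c′ d ⊗ₚ Idₚ) := b) refl a b c′ d ,
    solve 4 (λ a b c′ d → p₂₁ (pmat a b c′ d ⊗ₚ Idₚ) := c′) refl a b c′ d ,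
    solve 4 (λ a b c′ d → p₂₂ (pmat a b c′ d ⊗ₚ Idₚ) := d) refl a b c′ d

  M-cong : ∀ {xs ys} → xs ≋ ys → M xs ≈M M ys
  M-cong []       = ≈M-refl
  M-cong (p ∷ ps) = ⊗-cong (M-cong ps) (p , refl , refl , refl)

  M-++ : ∀ xs ys → M (xs ++ ys) ≈M (M ys ⊗ M xs)
  M-++ []       ys = ≈M-sym (⊗-identityʳ (M ys))
  M-++ (x ∷ xs) ys = ≈M-trans (⊗-cong (M-++ xs ys) ≈M-refl) (⊗-assoc (M ys) (M xs) (elem x))

  IsQuiddity-resp : ∀ {xs ys} → xs ≋ ys → IsQuiddity xs → IsQuiddity ys
  IsQuiddity-resp p (inj₁ q) = inj₁ (≈M-trans (≈M-sym (M-cong p)) q)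
  IsQuiddity-resp p (inj₂ q) = inj₂ (≈M-trans (≈M-sym (M-cong p)) q)

  det : Mat → Carrier
  det (mat a b c′ d) = a * d - b * c′

  det-⊗ : ∀ A B → det (A ⊗ B) ≈ det A * det B
  det-⊗ (mat a b c′ d) (mat e f g h) =
    solve 8 (λ a b c′ d e f g h → let pmat p q r s = pmat a b c′ d ⊗ₚ pmat e f g h in
               p :* s :- q :* r := (a :* d :- b :* c′) :* (e :* h :- f :* g))
            refl a b c′ d e f g h

  det-M : ∀ xs → det (M xs) ≈ 1#
  det-M []       = solve 0 (:1 :* :1 :- :0 :* :0 := :1) refl
  det-M (x ∷ xs) = begin
    det (M xs ⊗ elem x)      ≈⟨ det-⊗ (M xs) (elem x) ⟩
    det (M xs) * det (elem x) ≈⟨ *-cong (det-M xs) (solve 1 (λ x → x :* :0 :- (:- :1) :* :1 := :1) refl x) ⟩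
    1# * 1#                  ≈⟨ *-identityˡ 1# ⟩
    1#                       ∎
    where open import Relation.Binary.Reasoning.Setoid setoid

  det-cong : ∀ {A B} → A ≈M B → det A ≈ det B
  det-cong {mat _ _ _ _} {mat _ _ _ _} (p , q , r , s) = +-cong (*-cong p s) (-‿cong (*-cong q r))

  -- (elem y ⊗ A) ⊗ elem x, multiplied out
  bracketM : Carrier → Carrier → Mat → Mat
  bracketM x y (mat a b c′ d) = mat (y * (a * x + b) - (c′ * x + d)) (c′ - y * a) (a * x + b) (- a)

  bracketM-cong : ∀ x y {A B} → A ≈M B → bracketM x y A ≈M bracketM x y B
  bracketM-cong x y {mat _ _ _ _} {mat _ _ _ _} (p , q , r , s) =
    +-cong (*-cong refl (+-cong (*-cong p refl) q)) (-‿cong (+-cong (*-cong r refl) s)) ,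
    +-cong r (-‿cong (*-cong refl p)) , +-cong (*-cong p refl) q , -‿cong p

  M-bracket : ∀ x W y → M (x ∷ W ++ [ y ]) ≈M bracketM x y (M W)
  M-bracket x W y = ≈M-trans (⊗-cong (M-++ W [ y ]) ≈M-refl) (entries (M W))
    where
    entries : ∀ A → (((Id ⊗ elem y) ⊗ A) ⊗ elem x) ≈M bracketM x y A
    entries (mat a b c′ d) =
      solve 6 (λ x y a b c′ d → p₁₁ (lhs x y a b c′ d) := y :* (a :* x :+ b) :- (c′ :* x :+ d)) refl x y a b c′ d ,
      solve 6 (λ x y a b c′ d → p₁₂ (lhs x y a b c′ d) := c′ :- y :* a) refl x y a b c′ d ,
      solve 6 (λ x y a b c′ d → p₂₁ (lhs x y a b c′ d) := a :* x :+ b) refl x y a b c′ d ,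
      solve 6 (λ x y a b c′ d → p₂₂ (lhs x y a b c′ d) := :- a) refl x y a b c′ d
      where
      lhs : ∀ {n} (x y a b c′ d : Polynomial n) → PMat n
      lhs x y a b c′ d = ((Idₚ ⊗ₚ elemₚ y) ⊗ₚ pmat a b c′ d) ⊗ₚ elemₚ x

  quiddity-bracket⇒ : ∀ x W y {a b c′ d} → M W ≈M mat a b c′ d → IsQuiddity (x ∷ W ++ [ y ]) →
                   (- a ≈ 1# ⊎ - a ≈ - 1#) × (a * x + b ≈ 0#) × (c′ - y * a ≈ 0#)
  quiddity-bracket⇒ x W y p (inj₁ q) =
    let _ , e₁₂ , e₂₁ , e₂₂ = ≈M-trans (≈M-sym (≈M-trans (M-bracket x W y) (bracketM-cong x y p))) q
    in inj₁ e₂₂ , e₂₁ , e₁₂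
  quiddity-bracket⇒ x W y p (inj₂ q) =
    let _ , e₁₂ , e₂₁ , e₂₂ = ≈M-trans (≈M-sym (≈M-trans (M-bracket x W y) (bracketM-cong x y p))) q
    in inj₂ e₂₂ , e₂₁ , e₁₂

  -- The top-left entry of the bracket is - det (M W) = - 1.
  quiddity-bracket⇐ : ∀ x W y {b c′ d} → M W ≈M mat 1# b c′ d → x ≈ - b → y ≈ c′ →
                   IsQuiddity (x ∷ W ++ [ y ])
  quiddity-bracket⇐ x W y {b} {c′} {d} p x≈ y≈ =
    inj₂ (≈M-trans (M-bracket x W y) (≈M-trans (bracketM-cong x y p) (e₁₁ , e₁₂ , e₂₁ , refl)))
    where
    open import Relation.Binary.Reasoning.Setoid setoid
    e₁₁ : y * (1# * x + b) - (c′ * x + d) ≈ - 1#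
    e₁₁ = begin
      y * (1# * x + b) - (c′ * x + d)       ≈⟨ +-cong (*-cong y≈ (+-congʳ (*-congˡ x≈))) (-‿cong (+-congʳ (*-congˡ x≈))) ⟩
      c′ * (1# * - b + b) - (c′ * - b + d)  ≈⟨ solve 3 (λ b c′ d → c′ :* (:1 :* :- b :+ b) :- (c′ :* :- b :+ d)
                                                          := :- (:1 :* d :- b :* c′)) refl b c′ d ⟩
      - (1# * d - b * c′)                   ≈⟨ -‿cong (trans (det-cong (≈M-sym p)) (det-M W)) ⟩
      - 1#                                  ∎
    e₁₂ : c′ - y * 1# ≈ 0#
    e₁₂ = trans (+-congˡ (-‿cong (*-congʳ y≈))) (solve 1 (λ c′ → c′ :- c′ :* :1 := :0) refl c′)
    e₂₁ : 1# * x + b ≈ 0#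
    e₂₁ = trans (+-congʳ (*-congˡ x≈)) (solve 1 (λ b → :1 :* :- b :+ b := :0) refl b)

  ₐ-+ : ∀ m n → (m ℕ.+ n) ₐ ≈ m ₐ + n ₐ
  ₐ-+ zero    n = sym (+-identityˡ (n ₐ))
  ₐ-+ (suc m) n = trans (+-congˡ (ₐ-+ m n)) (sym (+-assoc 1# (m ₐ) (n ₐ)))

  twos : ℕ → List Carrier
  twos n = replicate n (2 ₐ)

  twosM : ℕ → Mat
  twosM j = mat (suc j ₐ) (- (j ₐ)) (j ₐ) (1# - j ₐ)

  twosₚ : ∀ {n} → Polynomial n → PMat n
  twosₚ J = pmat (:1 :+ J) (:- J) J (:1 :- J)

  M-2ʲ : ∀ j → M (twos j) ≈M twosM j
  M-2ʲ zero =
    solve 0 (:1 := :1 :+ :0) refl , solve 0 (:0 := :- :0) refl , refl , solve 0 (:1 := :1 :- :0) refl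
  M-2ʲ (suc j) = ≈M-trans (⊗-cong (M-2ʲ j) ≈M-refl)
    ( solve 1 (λ J → p₁₁ (step J) := :1 :+ (:1 :+ J)) refl (j ₐ)
    , solve 1 (λ J → p₁₂ (step J) := :- (:1 :+ J)) refl (j ₐ)
    , solve 1 (λ J → p₂₁ (step J) := :1 :+ J) refl (j ₐ)
    , solve 1 (λ J → p₂₂ (step J) := :1 :- (:1 :+ J)) refl (j ₐ) )
    where
    step : ∀ {n} → Polynomial n → PMat n
    step J = twosₚ J ⊗ₚ elemₚ (2 ₚ)

  M-1-2ʲ : ∀ j → M (1# ∷ twos j) ≈M mat 1# (- (suc j ₐ)) 1# (- (j ₐ))
  M-1-2ʲ j = ≈M-trans (⊗-cong (M-2ʲ j) ≈M-refl)
    ( solve 1 (λ J → p₁₁ (twosₚ J ⊗ₚ elemₚ :1) := :1) refl (j ₐ)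
    , solve 1 (λ J → p₁₂ (twosₚ J ⊗ₚ elemₚ :1) := :- (:1 :+ J)) refl (j ₐ)
    , solve 1 (λ J → p₂₁ (twosₚ J ⊗ₚ elemₚ :1) := :1) refl (j ₐ)
    , solve 1 (λ J → p₂₂ (twosₚ J ⊗ₚ elemₚ :1) := :- J) refl (j ₐ) )

  M-2ʲ-1 : ∀ j → M (twos j ++ [ 1# ]) ≈M mat 1# (- 1#) (suc j ₐ) (- (j ₐ))
  M-2ʲ-1 j = ≈M-trans (M-++ (twos j) [ 1# ]) (≈M-trans (⊗-cong ≈M-refl (M-2ʲ j))
    ( solve 1 (λ J → p₁₁ (prod J) := :1) refl (j ₐ)
    , solve 1 (λ J → p₁₂ (prod J) := :- :1) refl (j ₐ)
    , solve 1 (λ J → p₂₁ (prod J) := :1 :+ J) refl (j ₐ)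
    , solve 1 (λ J → p₂₂ (prod J) := :- J) refl (j ₐ) ))
    where
    prod : ∀ {n} → Polynomial n → PMat n
    prod J = (Idₚ ⊗ₚ elemₚ :1) ⊗ₚ twosₚ J

  M₁₁-v : ∀ v → Mat.e₁₁ (M [ v ]) ≈ v
  M₁₁-v = solve 1 (λ v → :1 :* v :+ :0 :* :1 := v) refl

  M₁₁-2ᵃ-1v : ∀ a v → Mat.e₁₁ (M (twos a ++ 1# ∷ v ∷ [])) + suc a ₐ ≈ v
  M₁₁-2ᵃ-1v a v = trans (+-congʳ (proj₁ (≈M-trans (M-++ (twos a) (1# ∷ v ∷ [])) (⊗-cong ≈M-refl (M-2ʲ a)))))
    (solve 2 (λ A v → p₁₁ (((Idₚ ⊗ₚ elemₚ v) ⊗ₚ elemₚ :1) ⊗ₚ twosₚ A) :+ (:1 :+ A) := v) refl (a ₐ) v)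

  M₁₁-v1-2ʲ : ∀ v j → Mat.e₁₁ (M (v ∷ 1# ∷ twos j)) + suc j ₐ ≈ v
  M₁₁-v1-2ʲ v j = trans (+-congʳ (proj₁ (⊗-cong (⊗-cong (M-2ʲ j) (≈M-refl {elem 1#})) (≈M-refl {elem v}))))
    (solve 2 (λ v J → p₁₁ ((twosₚ J ⊗ₚ elemₚ :1) ⊗ₚ elemₚ v) :+ (:1 :+ J) := v) refl v (j ₐ))

  M₁₁-2ᵃ-1v1-2ʲ : ∀ a v j → Mat.e₁₁ (M (twos a ++ 1# ∷ v ∷ 1# ∷ twos j)) + (2 ℕ.+ a ℕ.+ j) ₐ ≈ v
  M₁₁-2ᵃ-1v1-2ʲ a v j = begin
    Mat.e₁₁ (M (twos a ++ 1# ∷ v ∷ 1# ∷ twos j)) + (2 ℕ.+ a ℕ.+ j) ₐ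
      ≈⟨ +-cong (proj₁ (≈M-trans (M-++ (twos a) _) (⊗-cong inner (M-2ʲ a))))
                (+-congˡ (+-congˡ (ₐ-+ a j))) ⟩
    Mat.e₁₁ ((((twosM j ⊗ elem 1#) ⊗ elem v) ⊗ elem 1#) ⊗ twosM a) + (1# + (1# + (a ₐ + j ₐ)))
      ≈⟨ solve 3 (λ A v J → p₁₁ ((((twosₚ J ⊗ₚ elemₚ :1) ⊗ₚ elemₚ v) ⊗ₚ elemₚ :1) ⊗ₚ twosₚ A)
                              :+ (:1 :+ (:1 :+ (A :+ J))) := v) refl (a ₐ) v (j ₐ) ⟩
    v ∎
    where
    open import Relation.Binary.Reasoning.Setoid setoid
    inner : M (1# ∷ v ∷ 1# ∷ twos j) ≈M (((twosM j ⊗ elem 1#) ⊗ elem v) ⊗ elem 1#)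
    inner = ⊗-cong (⊗-cong (⊗-cong (M-2ʲ j) ≈M-refl) ≈M-refl) ≈M-refl

module Reduction {c ℓ} (R : CommutativeRing c ℓ) where
  open import Data.Nat as ℕ using (zero; suc)
  import Data.Nat.Properties as ℕ
  open import Data.Sum using (inj₁; inj₂)
  open import Data.Empty using (⊥; ⊥-elim)
  open import Data.List.Relation.Binary.Pointwise using ([]; _∷_)
  open import Data.Product using (Σ; _×_; _,_; proj₁; proj₂)
  open import Data.List using (List; []; _∷_; _++_; [_]; reverse; drop; take)
  import Data.List.Properties as List
  open import Relation.Binary.PropositionalEquality as ≡ using (_≡_; cong; cong₂; subst)
  open import Data.Nat.Tactic.RingSolver using (solve-∀)
  open import Level using (_⊔_)
  open CommutativeRing R
  open Over R
  open import Algebra.Properties.Ring ring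
    using (+-cancelʳ; +-cancelˡ; -‿injective; -‿involutive; +-inverseˡ-unique; x∙y⁻¹≈ε⇒x≈y)
  open import Data.List.Relation.Binary.Equality.Setoid setoid using (≋-setoid; ≋-refl; ≋-sym; ++⁺)
  open IntegerCoefficientSolver R using (solve; _:=_; _:+_; _:-_)
  open Matrices R
  open Lists

  data IsRotation (q : ℕ) (v : Carrier) : List Carrier → Set c where
    v1-2ᵠ-1   : IsRotation q v (v ∷ 1# ∷ (twos q ++ [ 1# ]))
    1-2ᵠ-1v   : IsRotation q v (1# ∷ (twos q ++ 1# ∷ v ∷ []))
    2ʳ-1v1-2ⁱ : ∀ r i → r ℕ.+ i ≡ q → IsRotation q v (twos r ++ 1# ∷ v ∷ 1# ∷ twos i)

  rotate-target : ∀ q v i → IsRotation q v (rotate i (1# ∷ v ∷ 1# ∷ twos q))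
  rotate-target q v zero          = subst (IsRotation q v) (≡.sym (List.++-identityʳ _)) (2ʳ-1v1-2ⁱ 0 q ≡.refl)
  rotate-target q v 1             = v1-2ᵠ-1
  rotate-target q v 2             = 1-2ᵠ-1v
  rotate-target q v (suc (suc (suc f))) =
    subst (IsRotation q v)
          (≡.sym (cong₂ (λ us ws → us ++ 1# ∷ v ∷ 1# ∷ ws) (drop-replicate f q (2 ₐ)) (take-replicate f q (2 ₐ))))
          (2ʳ-1v1-2ⁱ (q ℕ.∸ f) (f ℕ.⊓ q) (≡.trans (ℕ.+-comm (q ℕ.∸ f) (f ℕ.⊓ q)) (ℕ.m⊓n+n∸m≡n f q)))

  rotate-twos-++ : ∀ i r ys → rotate i (twos (i ℕ.+ r) ++ ys) ≡ twos r ++ ys ++ twos i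
  rotate-twos-++ i r ys =
    ≡.trans (cong₂ _++_ (drop-replicate-+-++ i r (2 ₐ) ys) (take-replicate-+-++ i r (2 ₐ) ys))
            (List.++-assoc (twos r) ys (twos i))

  rotate-2ᵠ-1v1 : ∀ q v i → IsRotation q v (rotate i (twos q ++ 1# ∷ v ∷ 1# ∷ []))
  rotate-2ᵠ-1v1 q v i with ℕ.≤-total i q
  ... | inj₁ i≤q with ℕ.m≤n⇒∃[o]m+o≡n i≤q
  ...   | r , ≡.refl = subst (IsRotation (i ℕ.+ r) v) (≡.sym (rotate-twos-++ i r _)) (2ʳ-1v1-2ⁱ r i (ℕ.+-comm r i))
  rotate-2ᵠ-1v1 q v i | inj₂ q≤i with ℕ.m≤n⇒∃[o]m+o≡n q≤i
  ... | e , ≡.refl =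
    subst (IsRotation q v) (≡.sym (cong₂ _++_ (drop-+-replicate-++ q e (2 ₐ) _) (take-+-replicate-++ q e (2 ₐ) _)))
          (past-twos e)
    where
    past-twos : ∀ e → IsRotation q v (drop e (1# ∷ v ∷ 1# ∷ []) ++ twos q ++ take e (1# ∷ v ∷ 1# ∷ []))
    past-twos zero                = subst (IsRotation q v) (≡.sym (cong (λ ws → 1# ∷ v ∷ 1# ∷ ws) (List.++-identityʳ _)))
                                          (2ʳ-1v1-2ⁱ 0 q ≡.refl)
    past-twos 1                   = v1-2ᵠ-1
    past-twos 2                   = 1-2ᵠ-1v
    past-twos (suc (suc (suc e))) = subst (IsRotation q v)
      (≡.sym (cong₂ (λ us ws → us ++ twos q ++ 1# ∷ v ∷ 1# ∷ ws) (List.drop-[] e) (List.take-[] e)))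
      (2ʳ-1v1-2ⁱ q 0 (ℕ.+-identityʳ q))

  reverse-target : ∀ q v → reverse (1# ∷ v ∷ 1# ∷ twos q) ≡ twos q ++ 1# ∷ v ∷ 1# ∷ []
  reverse-target q v = ≡.trans (List.reverse-++ (1# ∷ v ∷ 1# ∷ []) (twos q))
                               (cong (_++ 1# ∷ v ∷ 1# ∷ []) (reverse-replicate q (2 ₐ)))

  rotate-reverse-target : ∀ q v i → IsRotation q v (rotate i (reverse (1# ∷ v ∷ 1# ∷ twos q)))
  rotate-reverse-target q v i =
    subst (λ L → IsRotation q v (rotate i L)) (≡.sym (reverse-target q v)) (rotate-2ᵠ-1v1 q v i)

  data Window (j : ℕ) : List Carrier → Set (c ⊔ ℓ) where
    1-2ʲ  : Window j (1# ∷ twos j)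
    2ʲ-1  : Window j (twos j ++ [ 1# ])
    large : ∀ {W} s → Mat.e₁₁ (M W) ≈ suc (suc s) ₐ → Window j W

  +ₐ-cancelʳ : ∀ {x} m n → x + n ₐ ≈ (m ℕ.+ n) ₐ → x ≈ m ₐ
  +ₐ-cancelʳ {x} m n p = +-cancelʳ (n ₐ) x (m ₐ) (trans p (ₐ-+ m n))

  large-window : ∀ {j W v} q s n → v ≈ suc q ₐ → Mat.e₁₁ (M W) + n ₐ ≈ v → suc q ≡ suc (suc s) ℕ.+ n →
                 Window j W
  large-window q s n v≈ p q≡ = large s (+ₐ-cancelʳ (suc (suc s)) n (trans p (trans v≈ (reflexive (cong _ₐ q≡)))))

  record Suffix (j : ℕ) (L : List Carrier) : Set (c ⊔ ℓ) where
    constructor suffix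
    field
      prefix window : List Carrier
      split         : L ≡ prefix ++ window
      length-window : length window ≡ suc j
      kind          : Window j window

  suffix-v1-2ᵠ-1 : ∀ j s v → Suffix j (v ∷ 1# ∷ (twos (suc j ℕ.+ s) ++ [ 1# ]))
  suffix-v1-2ᵠ-1 j s v =
    suffix (v ∷ 1# ∷ twos (suc s)) (twos j ++ [ 1# ])
      (cong (λ ws → v ∷ 1# ∷ ws) (begin
        twos (suc j ℕ.+ s) ++ [ 1# ]                  ≡⟨ cong (λ n → twos (suc n) ++ [ 1# ]) (ℕ.+-comm j s) ⟩
        twos (suc s ℕ.+ j) ++ [ 1# ]                  ≡⟨ cong (_++ [ 1# ]) (replicate-+ (suc s) j (2 ₐ)) ⟩
        (twos (suc s) ++ twos j) ++ [ 1# ] ≡⟨ List.++-assoc (twos (suc s)) _ _ ⟩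
        twos (suc s) ++ twos j ++ [ 1# ]   ∎))
      (≡.trans (length-∷ʳ (twos j) 1#) (cong suc (List.length-replicate j)))
      2ʲ-1
    where open ≡.≡-Reasoning

  suffix-1-2ᵠ-1v : ∀ j s {v} → v ≈ suc (suc j ℕ.+ s) ₐ → Suffix j (1# ∷ (twos (suc j ℕ.+ s) ++ 1# ∷ v ∷ []))
  suffix-1-2ᵠ-1v zero s {v} v≈ =
    suffix (1# ∷ twos (suc s) ++ [ 1# ]) [ v ]
      (cong (1# ∷_) (≡.sym (List.++-assoc (twos (suc s)) [ 1# ] [ v ])))
      ≡.refl (large s (trans (M₁₁-v v) v≈))
  suffix-1-2ᵠ-1v (suc a) s {v} v≈ =
    suffix (1# ∷ twos (suc (suc s))) (twos a ++ 1# ∷ v ∷ [])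
      (cong (1# ∷_) (begin
        twos (suc (suc a) ℕ.+ s) ++ 1# ∷ v ∷ []                   ≡⟨ cong (λ n → twos n ++ 1# ∷ v ∷ []) (arith₁ a s) ⟩
        twos (suc (suc s) ℕ.+ a) ++ 1# ∷ v ∷ []                   ≡⟨ cong (_++ 1# ∷ v ∷ []) (replicate-+ (suc (suc s)) a (2 ₐ)) ⟩
        (twos (suc (suc s)) ++ twos a) ++ 1# ∷ v ∷ [] ≡⟨ List.++-assoc (twos (suc (suc s))) _ _ ⟩
        twos (suc (suc s)) ++ twos a ++ 1# ∷ v ∷ []   ∎))
      (≡.trans (List.length-++ (twos a)) (≡.trans (cong (ℕ._+ 2) (List.length-replicate a)) (ℕ.+-comm a 2)))
      (large-window (suc (suc a) ℕ.+ s) s (suc a) v≈ (M₁₁-2ᵃ-1v a v) (arith₂ a s))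
    where
    open ≡.≡-Reasoning
    arith₁ : ∀ a s → suc (suc a) ℕ.+ s ≡ suc (suc s) ℕ.+ a
    arith₁ = solve-∀
    arith₂ : ∀ a s → suc (suc (suc a) ℕ.+ s) ≡ suc (suc s) ℕ.+ suc a
    arith₂ = solve-∀

  suffix-2ʳ-1v1-2ⁱ : ∀ j s {v} r i → v ≈ suc (suc j ℕ.+ s) ₐ → r ℕ.+ i ≡ suc j ℕ.+ s →
                     Suffix j (twos r ++ 1# ∷ v ∷ 1# ∷ twos i)
  suffix-2ʳ-1v1-2ⁱ j s r i v≈ r+i≡q with ℕ.compare j i
  suffix-2ʳ-1v1-2ⁱ j s {v} r .(suc (j ℕ.+ k)) _ _ | ℕ.less .j k =
    suffix (twos r ++ 1# ∷ v ∷ 1# ∷ twos k) (twos (suc j))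
      (≡.trans (cong (λ ws → twos r ++ 1# ∷ v ∷ 1# ∷ ws)
                     (≡.trans (cong (λ n → twos n) (arith j k)) (replicate-+ k (suc j) (2 ₐ))))
               (≡.sym (List.++-assoc (twos r) (1# ∷ v ∷ 1# ∷ twos k) (twos (suc j)))))
      (List.length-replicate (suc j))
      (large j (proj₁ (M-2ʲ (suc j))))
    where
    arith : ∀ j k → suc (j ℕ.+ k) ≡ k ℕ.+ suc j
    arith = solve-∀
  suffix-2ʳ-1v1-2ⁱ j s {v} r .j _ _ | ℕ.equal .j =
    suffix (twos r ++ 1# ∷ v ∷ []) (1# ∷ twos j)
      (≡.sym (List.++-assoc (twos r) (1# ∷ v ∷ []) (1# ∷ twos j)))
      (cong suc (List.length-replicate j))
      1-2ʲ
  suffix-2ʳ-1v1-2ⁱ .(suc (i ℕ.+ 0)) s {v} r i v≈ _ | ℕ.greater .i zero =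
    suffix (twos r ++ [ 1# ]) (v ∷ 1# ∷ twos i)
      (≡.sym (List.++-assoc (twos r) [ 1# ] (v ∷ 1# ∷ twos i)))
      (cong (λ n → suc (suc n)) (≡.trans (List.length-replicate i) (≡.sym (ℕ.+-identityʳ i))))
      (large-window _ s (suc i) v≈ (M₁₁-v1-2ʲ v i) (arith i s))
    where
    arith : ∀ i s → suc (suc (suc (i ℕ.+ 0)) ℕ.+ s) ≡ suc (suc s) ℕ.+ suc i
    arith = solve-∀
  suffix-2ʳ-1v1-2ⁱ .(suc (i ℕ.+ suc a)) s {v} r i v≈ r+i≡q | ℕ.greater .i (suc a) =
    suffix (twos (3 ℕ.+ s)) (twos a ++ block)
      (begin
        twos r ++ block                                ≡⟨ cong (λ n → twos n ++ block) r≡ ⟩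
        twos (3 ℕ.+ s ℕ.+ a) ++ block                  ≡⟨ cong (_++ block) (replicate-+ (3 ℕ.+ s) a (2 ₐ)) ⟩
        (twos (3 ℕ.+ s) ++ twos a) ++ block ≡⟨ List.++-assoc (twos (3 ℕ.+ s)) _ _ ⟩
        twos (3 ℕ.+ s) ++ twos a ++ block   ∎)
      (≡.trans (List.length-++ (twos a))
               (≡.trans (cong₂ (λ m n → m ℕ.+ suc (suc (suc n))) (List.length-replicate a) (List.length-replicate i))
                        (arith₁ a i)))
      (large-window _ s (2 ℕ.+ a ℕ.+ i) v≈ (M₁₁-2ᵃ-1v1-2ʲ a v i) (arith₂ a i s))
    where
    open ≡.≡-Reasoning
    block : List Carrier
    block = 1# ∷ v ∷ 1# ∷ twos i
    arith₀ : ∀ a i s → suc (suc (i ℕ.+ suc a)) ℕ.+ s ≡ 3 ℕ.+ s ℕ.+ a ℕ.+ i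
    arith₀ = solve-∀
    r≡ : r ≡ 3 ℕ.+ s ℕ.+ a
    r≡ = ℕ.+-cancelʳ-≡ i r (3 ℕ.+ s ℕ.+ a) (≡.trans r+i≡q (arith₀ a i s))
    arith₁ : ∀ a i → a ℕ.+ suc (suc (suc i)) ≡ suc (suc (i ℕ.+ suc a))
    arith₁ = solve-∀
    arith₂ : ∀ a i s → suc (suc (suc (i ℕ.+ suc a)) ℕ.+ s) ≡ suc (suc s) ℕ.+ (2 ℕ.+ a ℕ.+ i)
    arith₂ = solve-∀

  rotation-suffix : ∀ j s {v L} → v ≈ suc (suc j ℕ.+ s) ₐ → IsRotation (suc j ℕ.+ s) v L → Suffix j L
  rotation-suffix j s v≈ v1-2ᵠ-1                  = suffix-v1-2ᵠ-1 j s _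
  rotation-suffix j s v≈ 1-2ᵠ-1v                  = suffix-1-2ᵠ-1v j s v≈
  rotation-suffix j s v≈ (2ʳ-1v1-2ⁱ r i r+i≡q) = suffix-2ʳ-1v1-2ⁱ j s r i v≈ r+i≡q

  lst-bracket : ∀ x zs y → lst (x ∷ zs ++ [ y ]) ≡ y
  lst-bracket x []       y = ≡.refl
  lst-bracket x (z ∷ zs) y = lst-bracket z zs y

  mid-bracket : ∀ x zs y → mid (x ∷ zs ++ [ y ]) ≡ zs
  mid-bracket x zs y = ≡.trans (cong (λ n → take (n ℕ.∸ 1) (zs ++ [ y ])) (length-∷ʳ zs y)) (take-length-++ zs [ y ])

  ⊕-bracket : ∀ a ys b x zs y → (a ∷ ys ++ [ b ]) ⊕ (x ∷ zs ++ [ y ]) ≡ ((a + y) ∷ ys ++ [ b + x ]) ++ zs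
  ⊕-bracket a ys b x zs y = begin
    (a ∷ ys ++ [ b ]) ⊕ (x ∷ zs ++ [ y ])
      ≡⟨ cong₂ (λ l r → (a + l) ∷ r) (lst-bracket x zs y)
               (cong₂ (λ m l → m ++ (l + x) ∷ mid (x ∷ zs ++ [ y ])) (mid-bracket a ys b) (lst-bracket a ys b)) ⟩
    (a + y) ∷ ys ++ (b + x) ∷ mid (x ∷ zs ++ [ y ])   ≡⟨ cong (λ m → (a + y) ∷ ys ++ (b + x) ∷ m) (mid-bracket x zs y) ⟩
    (a + y) ∷ ys ++ (b + x) ∷ zs                      ≡⟨ cong ((a + y) ∷_) (List.++-assoc ys [ b + x ] zs) ⟨
    ((a + y) ∷ ys ++ [ b + x ]) ++ zs                 ∎
    where open ≡.≡-Reasoning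

  1*x+b≈0⇒x≈-b : ∀ {x b} → 1# * x + b ≈ 0# → x ≈ - b
  1*x+b≈0⇒x≈-b {x} {b} p = +-inverseˡ-unique x b (trans (+-congʳ (sym (*-identityˡ x))) p)

  c-y*1≈0⇒y≈c : ∀ {y c′} → c′ - y * 1# ≈ 0# → y ≈ c′
  c-y*1≈0⇒y≈c {y} {c′} p = trans (sym (*-identityʳ y)) (sym (x∙y⁻¹≈ε⇒x≈y c′ (y * 1#) p))

  ₐ-minus-2 : ∀ n → suc (suc (suc n)) ₐ - 2 ₐ ≈ suc n ₐ
  ₐ-minus-2 n = solve 1 (λ N → (:1 :+ (:1 :+ (:1 :+ N))) :- 2 ₚ := :1 :+ N) refl (n ₐ)

  reduced-length : ∀ j s (bs : List Carrier) → length bs ≡ 3 ℕ.+ j →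
                   length (target (3 ℕ.+ (suc j ℕ.+ s))) ℕ.+ 2 ℕ.∸ length bs ≡ 3 ℕ.+ s
  reduced-length j s bs len-bs = begin
    length (target (3 ℕ.+ (suc j ℕ.+ s))) ℕ.+ 2 ℕ.∸ length bs
      ≡⟨ cong₂ (λ m n → m ℕ.+ 2 ℕ.∸ n) (cong (3 ℕ.+_) (List.length-replicate (suc j ℕ.+ s))) len-bs ⟩
    suc j ℕ.+ s ℕ.+ 2 ℕ.∸ j   ≡⟨ cong (ℕ._∸ j) (arith j s) ⟩
    j ℕ.+ (3 ℕ.+ s) ℕ.∸ j     ≡⟨ ℕ.m+n∸m≡n j (3 ℕ.+ s) ⟩
    3 ℕ.+ s                   ∎
    where
    open ≡.≡-Reasoning
    arith : ∀ j s → suc j ℕ.+ s ℕ.+ 2 ≡ j ℕ.+ (3 ℕ.+ s)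
    arith = solve-∀

  length-bracket : ∀ j (x : Carrier) zs y → length (x ∷ zs ++ [ y ]) ≡ 3 ℕ.+ j → length zs ≡ suc j
  length-bracket j x zs y len = ℕ.suc-injective (≡.trans (≡.sym (length-∷ʳ zs y)) (ℕ.suc-injective len))

  rotation-of-target : ∀ q {L} → target (3 ℕ.+ q) ∼ L →
                       Σ (List Carrier) λ L′ → IsRotation q (suc (suc (suc q)) ₐ - 2 ₐ) L′ × L ≋ L′
  rotation-of-target q (i , inj₁ p) = _ , rotate-target q _ i , p
  rotation-of-target q (i , inj₂ p) = _ , rotate-reverse-target q _ i , p

  reduction-window : ∀ j s {cs x zs y} → length cs ≡ 3 ℕ.+ s → length zs ≡ suc j →
                     target (3 ℕ.+ (suc j ℕ.+ s)) ∼ (cs ⊕ (x ∷ zs ++ [ y ])) →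
                     Σ (List Carrier) λ W → zs ≋ W × Window j W
  reduction-window j s {cs} {x} {zs} {y} len-cs len-zs related
    with bracketed cs len-cs
  ... | bracket a ys b = window , ++⁻ʳ _ prefix (≡.trans len-zs (≡.sym length-window)) zs≋ , kind
    where
    rotated : Σ (List Carrier) λ L′ → IsRotation (suc j ℕ.+ s) _ L′ × ((a ∷ ys ++ [ b ]) ⊕ (x ∷ zs ++ [ y ])) ≋ L′
    rotated = rotation-of-target (suc j ℕ.+ s) related
    open Suffix (rotation-suffix j s (ₐ-minus-2 (suc j ℕ.+ s)) (proj₁ (proj₂ rotated)))
    zs≋ : (((a + y) ∷ ys ++ [ b + x ]) ++ zs) ≋ (prefix ++ window)
    zs≋ = ≡.subst₂ _≋_ (⊕-bracket a ys b x zs y) split (proj₂ (proj₂ rotated))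

  -[2+s]≉±1 : CharZero → ∀ s {w} → w ≈ suc (suc s) ₐ → - w ≈ 1# ⊎ - w ≈ - 1# → ⊥
  -[2+s]≉±1 cz s {w} w≈ (inj₁ -w≈1) =
    cz (suc (suc s)) (trans (+-cong (sym -w≈1) (sym w≈)) (-‿inverseˡ w))
  -[2+s]≉±1 cz s {w} w≈ (inj₂ -w≈-1) =
    cz s (+-cancelˡ 1# (suc s ₐ) 0# (trans (sym w≈) (trans (-‿injective -w≈-1) (sym (+-identityʳ 1#)))))

  solution-of-window : CharZero → ∀ {j x zs W y} → zs ≋ W → Window j W → IsQuiddity (x ∷ W ++ [ y ]) →
                       (x ∷ zs ++ [ y ]) ≋ sol₁ (3 ℕ.+ j) ⊎ (x ∷ zs ++ [ y ]) ≋ sol₂ (3 ℕ.+ j)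
  solution-of-window cz {j} {x} {y = y} zs≋W 1-2ʲ quiddity
    with quiddity-bracket⇒ x (1# ∷ twos j) y (M-1-2ʲ j) quiddity
  ... | _ , x-eq , y-eq =
    inj₁ (trans (1*x+b≈0⇒x≈-b x-eq) (trans (-‿involutive _) (sym (ₐ-minus-2 j))) ∷
          ++⁺ zs≋W (c-y*1≈0⇒y≈c y-eq ∷ []))
  solution-of-window cz {j} {x} {zs} {y = y} zs≋W 2ʲ-1 quiddity
    with quiddity-bracket⇒ x (twos j ++ [ 1# ]) y (M-2ʲ-1 j) quiddity
  ... | _ , x-eq , y-eq =
    inj₂ (trans (1*x+b≈0⇒x≈-b x-eq) (-‿involutive 1#) ∷
          ≡.subst ((zs ++ [ y ]) ≋_) (List.++-assoc (twos j) [ 1# ] _)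
                  (++⁺ zs≋W (trans (c-y*1≈0⇒y≈c y-eq) (sym (ₐ-minus-2 j)) ∷ [])))
  solution-of-window cz {x = x} {W = W} {y} zs≋W (large s w≈) quiddity =
    ⊥-elim (-[2+s]≉±1 cz s w≈ (proj₁ (quiddity-bracket⇒ x W y ≈M-refl quiddity)))

  forward : CharZero → ∀ j s bs → length bs ≡ 3 ℕ.+ j → CanReduce bs (target (3 ℕ.+ (suc j ℕ.+ s))) →
            bs ≋ sol₁ (3 ℕ.+ j) ⊎ bs ≋ sol₂ (3 ℕ.+ j)
  forward cz j s bs len-bs (quiddity , cs , len-cs , related) with bracketed bs len-bs
  ... | bracket x zs y with reduction-window j s {cs} (≡.trans len-cs (reduced-length j s (x ∷ zs ++ [ y ]) len-bs))
                                                     (length-bracket j x zs y len-bs) related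
  ... | W , zs≋W , window =
    solution-of-window cz zs≋W window (IsQuiddity-resp (refl ∷ ++⁺ zs≋W ≋-refl) quiddity)

  sol₁-quiddity : ∀ j → IsQuiddity (sol₁ (3 ℕ.+ j))
  sol₁-quiddity j =
    quiddity-bracket⇐ _ (1# ∷ twos j) 1# (M-1-2ʲ j) (trans (ₐ-minus-2 j) (sym (-‿involutive _))) refl

  sol₂-quiddity : ∀ j → IsQuiddity (sol₂ (3 ℕ.+ j))
  sol₂-quiddity j = ≡.subst IsQuiddity (cong (1# ∷_) (List.++-assoc (twos j) [ 1# ] _))
                           (quiddity-bracket⇐ 1# (twos j ++ [ 1# ]) _ (M-2ʲ-1 j) (sym (-‿involutive 1#)) (ₐ-minus-2 j))

  bracket-≋ : ∀ {x zs y x′ W y′} → length zs ≡ length W → (x ∷ zs ++ [ y ]) ≋ (x′ ∷ W ++ [ y′ ]) →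
              x ≈ x′ × zs ≋ W × y ≈ y′
  bracket-≋ {zs = zs} {W = W} len (x≈ ∷ p) with ++⁻ zs W len p
  ... | zs≋W , y≈ ∷ [] = x≈ , zs≋W , y≈

  middle-sum : ∀ j s {z} → z ≈ (3 ℕ.+ j) ₐ - 2 ₐ → suc s ₐ + z ≈ (3 ℕ.+ (suc j ℕ.+ s)) ₐ - 2 ₐ
  middle-sum j s {z} z≈ = begin
    suc s ₐ + z                          ≈⟨ +-congˡ (trans z≈ (ₐ-minus-2 j)) ⟩
    suc s ₐ + suc j ₐ                    ≈⟨ ₐ-+ (suc s) (suc j) ⟨
    (suc s ℕ.+ suc j) ₐ                  ≡⟨ cong _ₐ (arith s j) ⟩
    suc (suc j ℕ.+ s) ₐ                  ≈⟨ ₐ-minus-2 (suc j ℕ.+ s) ⟨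
    (3 ℕ.+ (suc j ℕ.+ s)) ₐ - 2 ₐ        ∎
    where
    open import Relation.Binary.Reasoning.Setoid setoid
    arith : ∀ s j → suc s ℕ.+ suc j ≡ suc (suc j ℕ.+ s)
    arith = solve-∀

  1+≈2 : ∀ {z} → z ≈ 1# → 1# + z ≈ 2 ₐ
  1+≈2 z≈ = +-congˡ (trans z≈ (sym (+-identityʳ 1#)))

  sol₁-reduces : ∀ j s bs → length bs ≡ 3 ℕ.+ j → bs ≋ sol₁ (3 ℕ.+ j) → CanReduce bs (target (3 ℕ.+ (suc j ℕ.+ s)))
  sol₁-reduces j s bs len-bs p with bracketed bs len-bs
  ... | bracket x zs y =
    IsQuiddity-resp (≋-sym p) (sol₁-quiddity j) ,
    cs , ≡.trans len-cs (≡.sym (reduced-length j s (x ∷ zs ++ [ y ]) len-bs)) , j , inj₂ rotated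
    where
    v : Carrier
    v = (3 ℕ.+ (suc j ℕ.+ s)) ₐ - 2 ₐ
    cs : List Carrier
    cs = 1# ∷ (twos s ++ [ 1# ]) ++ [ suc s ₐ ]
    len-cs : length cs ≡ 3 ℕ.+ s
    len-cs = cong suc (≡.trans (length-∷ʳ (twos s ++ [ 1# ]) (suc s ₐ))
                               (cong suc (≡.trans (length-∷ʳ (twos s) 1#) (cong suc (List.length-replicate s)))))
    pieces : x ≈ (3 ℕ.+ j) ₐ - 2 ₐ × zs ≋ (1# ∷ twos j) × y ≈ 1#
    pieces = bracket-≋ (≡.trans (length-bracket j x zs y len-bs) (≡.sym (cong suc (List.length-replicate j)))) p
    rotation : rotate j (reverse (target (3 ℕ.+ (suc j ℕ.+ s)))) ≡ twos (suc s) ++ 1# ∷ v ∷ 1# ∷ twos j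
    rotation = ≡.trans (cong (rotate j) (reverse-target (suc j ℕ.+ s) v))
               (≡.trans (cong (λ n → rotate j (twos n ++ 1# ∷ v ∷ 1# ∷ [])) (≡.sym (ℕ.+-suc j s)))
                        (rotate-twos-++ j (suc s) _))
    rotated : (cs ⊕ (x ∷ zs ++ [ y ])) ≋ rotate j (reverse (target (3 ℕ.+ (suc j ℕ.+ s))))
    rotated = begin
      cs ⊕ (x ∷ zs ++ [ y ])
        ≡⟨ ⊕-bracket 1# (twos s ++ [ 1# ]) (suc s ₐ) x zs y ⟩
      ((1# + y) ∷ (twos s ++ [ 1# ]) ++ [ suc s ₐ + x ]) ++ zs
        ≡⟨ cong ((1# + y) ∷_) (≡.trans (List.++-assoc (twos s ++ [ 1# ]) _ zs)
                                       (List.++-assoc (twos s) [ 1# ] _)) ⟩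
      (1# + y) ∷ twos s ++ 1# ∷ (suc s ₐ + x) ∷ zs
        ≈⟨ 1+≈2 (proj₂ (proj₂ pieces)) ∷ ++⁺ ≋-refl (refl ∷ middle-sum j s (proj₁ pieces) ∷ proj₁ (proj₂ pieces)) ⟩
      2 ₐ ∷ twos s ++ 1# ∷ v ∷ 1# ∷ twos j
        ≡⟨ rotation ⟨
      rotate j (reverse (target (3 ℕ.+ (suc j ℕ.+ s)))) ∎
      where open import Relation.Binary.Reasoning.Setoid ≋-setoid

  sol₂-reduces : ∀ j s bs → length bs ≡ 3 ℕ.+ j → bs ≋ sol₂ (3 ℕ.+ j) → CanReduce bs (target (3 ℕ.+ (suc j ℕ.+ s)))
  sol₂-reduces j s bs len-bs p with bracketed bs len-bs
  ... | bracket x zs y =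
    IsQuiddity-resp (≋-sym p) (sol₂-quiddity j) ,
    cs , ≡.trans len-cs (≡.sym (reduced-length j s (x ∷ zs ++ [ y ]) len-bs)) , 1 , inj₁ rotated
    where
    v : Carrier
    v = (3 ℕ.+ (suc j ℕ.+ s)) ₐ - 2 ₐ
    cs : List Carrier
    cs = suc s ₐ ∷ (1# ∷ twos s) ++ [ 1# ]
    len-cs : length cs ≡ 3 ℕ.+ s
    len-cs = cong (λ n → suc (suc n)) (≡.trans (length-∷ʳ (twos s) 1#) (cong suc (List.length-replicate s)))
    pieces : x ≈ 1# × zs ≋ (twos j ++ [ 1# ]) × y ≈ (3 ℕ.+ j) ₐ - 2 ₐ
    pieces = bracket-≋ (≡.trans (length-bracket j x zs y len-bs)
                                (≡.sym (≡.trans (length-∷ʳ (twos j) 1#) (cong suc (List.length-replicate j)))))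
                       (≡.subst ((x ∷ zs ++ [ y ]) ≋_) (cong (1# ∷_) (≡.sym (List.++-assoc (twos j) [ 1# ] _))) p)
    twos-split : twos (suc j ℕ.+ s) ++ [ 1# ] ≡ twos s ++ 2 ₐ ∷ twos j ++ [ 1# ]
    twos-split = ≡.trans (cong (λ n → twos n ++ [ 1# ]) (ℕ.+-comm (suc j) s))
                 (≡.trans (cong (_++ [ 1# ]) (replicate-+ s (suc j) (2 ₐ)))
                          (List.++-assoc (twos s) (twos (suc j)) [ 1# ]))
    rotated : (cs ⊕ (x ∷ zs ++ [ y ])) ≋ rotate 1 (target (3 ℕ.+ (suc j ℕ.+ s)))
    rotated = begin
      cs ⊕ (x ∷ zs ++ [ y ])
        ≡⟨ ⊕-bracket (suc s ₐ) (1# ∷ twos s) 1# x zs y ⟩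
      ((suc s ₐ + y) ∷ (1# ∷ twos s) ++ [ 1# + x ]) ++ zs
        ≡⟨ cong (λ l → (suc s ₐ + y) ∷ 1# ∷ l) (List.++-assoc (twos s) [ 1# + x ] zs) ⟩
      (suc s ₐ + y) ∷ 1# ∷ twos s ++ (1# + x) ∷ zs
        ≈⟨ middle-sum j s (proj₂ (proj₂ pieces)) ∷ refl ∷ ++⁺ ≋-refl (1+≈2 (proj₁ pieces) ∷ proj₁ (proj₂ pieces)) ⟩
      v ∷ 1# ∷ twos s ++ 2 ₐ ∷ twos j ++ [ 1# ]
        ≡⟨ cong (λ l → v ∷ 1# ∷ l) twos-split ⟨
      rotate 1 (target (3 ℕ.+ (suc j ℕ.+ s))) ∎
      where open import Relation.Binary.Reasoning.Setoid ≋-setoid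

  backward : ∀ j s bs → length bs ≡ 3 ℕ.+ j → bs ≋ sol₁ (3 ℕ.+ j) ⊎ bs ≋ sol₂ (3 ℕ.+ j) →
             CanReduce bs (target (3 ℕ.+ (suc j ℕ.+ s)))
  backward j s bs len-bs (inj₁ p) = sol₁-reduces j s bs len-bs p
  backward j s bs len-bs (inj₂ p) = sol₂-reduces j s bs len-bs p

open import Data.Nat using (suc; s≤s)
open import Data.Nat.Properties using (m≤n⇒∃[o]m+o≡n)
open import Data.Product using (_,_)
open import Relation.Binary.PropositionalEquality using (refl)
open import Function.Bundles using (mk⇔)

-- 4 ≤ n is implied by 3 ≤ k < n; write k = 3 + j and n = 3 + (suc j + s).
mainTheorem17 : ∀ {c ℓ} (R : CommutativeRing c ℓ) → Defs.Over.CharZero R →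
    (n k : ℕ) → 4 ≤ n → 3 ≤ k → k < n →
    (bs : List (CommutativeRing.Carrier R)) → length bs ≡ k →
    Defs.Over.CanReduce R bs (Defs.Over.target R n)
      ⇔ (Defs.Over._≋_ R bs (Defs.Over.sol₁ R k) ⊎ Defs.Over._≋_ R bs (Defs.Over.sol₂ R k))
mainTheorem17 R charZero _ (suc (suc (suc j))) _ (s≤s (s≤s (s≤s _))) (s≤s (s≤s (s≤s j<q))) bs len-bs
  with m≤n⇒∃[o]m+o≡n j<q
... | s , refl = mk⇔ (forward charZero j s bs len-bs) (backward j s bs len-bs)
  where open Reduction R
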